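{- Let $n \ge 1$ be an integer, let $\mathcal{F}$ be the set of all partial orders on $[n]=\{1,\dots,n\}$, and let $\mathcal{G}\subseteq\mathcal{F}$ be the set of all total orders on $[n]$. Regard $\mathcal{G}$ as a family of subsets of the ground set $\mathcal{F}$ by identifying each $B\in\mathcal{G}$ with the set $\{A\in\mathcal{F} : A \text{ is compatible with } B\}$. Then the VC-dimension $\mathrm{VC}_{\mathcal{F}}(\mathcal{G})$ of this set family satisfies \[ 2(n-3) \le \mathrm{VC}_{\mathcal{F}}(\mathcal{G}) \le n\log_2 n. \]
   Context: Two partial orders $<_1,<_2$ on $[n]$ are called compatible if there exists a partial order on $[n]$ finer than both (i.e. containing both relations), equivalently if the directed graph on $[n]$ whose edge set is $<_1\cup<_2$ (an edge $a\to b$ whenever $a<_1 b$ or $a<_2 b$) is acyclic. The empty relation counts as a partial order. For a family $\mathcal{H}$ of subsets of a set $X$, a subset $S\subseteq X$ is shattered by $\mathcal{H}$ if for every $A\subseteq S$ there is $B\in\mathcal{H}$ with $B\cap S=A$; the VC-dimension of $\mathcal{H}$ on $X$ is the largest cardinality of a subset of $X$ shattered by $\mathcal{H}$. Here $\mathrm{VC}_{\mathcal{F}}(\mathcal{G})$ denotes the VC-dimension of the family $\{\{A\in\mathcal{F}: A \text{ compatible with } B\} : B\in\mathcal{G}\}$ on the ground set $\mathcal{F}$. -}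

module Defs where

open import Data.Nat using (ℕ; _≤_)
open import Data.Fin using (Fin)
open import Data.Bool using (Bool; true; false)
open import Data.Sum using (_⊎_)
open import Data.Product using (Σ; ∃; ∃-syntax; _×_)
open import Data.List using (List; length; lookup)
open import Data.List.Relation.Unary.All using (All)
open import Data.List.Relation.Unary.AllPairs using (AllPairs)
open import Relation.Nullary using (¬_)
open import Relation.Binary.PropositionalEquality using (_≡_; _≢_)
open import Relation.Binary.Construct.Closure.Transitive using (TransClosure)

-- A (decidable) binary relation on [n] = Fin n; R a b ≡ true means a < b.
Rel : ℕ → Set
Rel n = Fin n → Fin n → Bool

-- A partial order, given by its strict part: irreflexive and transitive.
-- (The empty relation is a partial order.)
IsPartialOrder : {n : ℕ} → Rel n → Set
IsPartialOrder {n} R =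
  (∀ (a : Fin n) → R a a ≡ false) ×
  (∀ (a b c : Fin n) → R a b ≡ true → R b c ≡ true → R a c ≡ true)

IsTotalOrder : {n : ℕ} → Rel n → Set
IsTotalOrder {n} R =
  IsPartialOrder R ×
  (∀ (a b : Fin n) → a ≢ b → (R a b ≡ true) ⊎ (R b a ≡ true))

UnionEdge : {n : ℕ} → Rel n → Rel n → Fin n → Fin n → Set
UnionEdge R₁ R₂ a b = (R₁ a b ≡ true) ⊎ (R₂ a b ≡ true)

Acyclic : {n : ℕ} → (Fin n → Fin n → Set) → Set
Acyclic {n} E = ∀ (a : Fin n) → ¬ TransClosure E a a

Compatible : {n : ℕ} → Rel n → Rel n → Set
Compatible R₁ R₂ = Acyclic (UnionEdge R₁ R₂)

Distinct : {n : ℕ} → Rel n → Rel n → Set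
Distinct {n} R₁ R₂ = ∃[ a ] ∃[ b ] (R₁ a b ≢ R₂ a b)

-- A finite subset S of the ground set F (all partial orders on [n]),
-- listed without repetition.
IsSubsetOfF : {n : ℕ} → List (Rel n) → Set
IsSubsetOfF S = All IsPartialOrder S × AllPairs Distinct S

-- S is shattered by the family {{A ∈ F : A compatible with B} : B ∈ G}, G = total orders:
-- for every subset T ⊆ S (given by its indicator χ) there is a total order B
-- with {A ∈ S : A compatible with B} = T.
Shattered : {n : ℕ} → List (Rel n) → Set
Shattered {n} S =
  ∀ (χ : Fin (length S) → Bool) →
    ∃[ B ] (IsTotalOrder B ×
      (∀ (i : Fin (length S)) → (Compatible (lookup S i) B → χ i ≡ true)
                               × (χ i ≡ true → Compatible (lookup S i) B)))

IsVCDim : ℕ → ℕ → Set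
IsVCDim n d =
  (∃[ S ] (IsSubsetOfF {n} S × Shattered S × length S ≡ d)) ×
  (∀ (S : List (Rel n)) → IsSubsetOfF S → Shattered S → length S ≤ d)

{-# OPTIONS --safe #-}
module Submission where

-- A partial order A is compatible with a total order B exactly when A ⊆ B, so S is
-- shattered when every subset of S is the set of members of S contained in some total order.
--
-- Upper bound: distinct subsets of a shattered S need distinct total orders, and a total order
-- is determined by its height function (number of predecessors) [n] → [n]; hence 2^|S| ≤ n^n.
--
-- Lower bound: on m + 3 points take poles low, mid, high and points e₁ … e_m, and the 2m
-- partial orders low < e_k < high and e_k < mid. A total order with low < mid < high in which
-- each e_k sits in one of the four gaps, chosen independently, realises every subset.
--
-- Existence of the VC-dimension: relations on [n] are finite objects, so an exhaustive search
-- (up to pointwise equality) decides whether a shattered subset of size k exists; sizes are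
-- bounded by n^n, so a greatest one exists.

open import Defs

open import Data.Bool using (Bool; true; false; _∧_)
open import Data.Bool.Properties using (T-≡; ∧-conicalˡ; ∧-conicalʳ; ⇔→≡) renaming (_≟_ to _≟ᵇ_)
open import Data.Empty using (⊥-elim)
open import Data.Fin
  using (Fin; zero; suc; toℕ; fromℕ<; cast; combine; splitAt; join; funToFin; finToFun; #_; _≟_)
open import Data.Fin.Properties
  using ( all?; any?; toℕ-injective; fromℕ<-injective; cast-involutive; combine-monoˡ-<
        ; combine-injective; join-splitAt; +↔⊎; 2↔Bool; injective⇒≤; funToFin-finToFin
        ; finToFun-funToFin)
open import Data.Fin.Subset using (Subset; _∈_; ∣_∣)
open import Data.Fin.Subset.Properties using (p⊂q⇒∣p∣<∣q∣; ⊆⊤; ∈⊤; ∣⊤∣≡n)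
open import Data.List using (List; []; length; lookup; tabulate)
open import Data.List.Properties using (length-tabulate; lookup-tabulate; tabulate-lookup)
import Data.List.Relation.Binary.Pointwise as Listʷ
open import Data.List.Relation.Unary.All using ([])
import Data.List.Relation.Unary.All as All
import Data.List.Relation.Unary.All.Properties as All
open import Data.List.Relation.Unary.AllPairs using ([])
import Data.List.Relation.Unary.AllPairs as AllPairs
import Data.List.Relation.Unary.AllPairs.Properties as AllPairs
open import Data.Nat using (ℕ; zero; suc; _+_; _*_; _∸_; _^_; _≤_; _<_; _<ᵇ_; z≤n; s≤s; s≤s⁻¹)
open import Data.Nat.Properties
  using ( ≤-refl; ≤-trans; <-trans; <-asym; <⇒≤; ≤⇒≯; ≤∧≢⇒<; <-cmp; <ᵇ⇒<; <⇒<ᵇ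
        ; +-mono-≤; m≤m+n; m^n>0; +-identityʳ)
open import Data.Product using (∃; ∃-syntax; _×_; _,_; proj₁; proj₂)
import Data.Product as Product
open import Data.Sum using (_⊎_; inj₁; inj₂; [_,_]′)
import Data.Sum as Sum
import Data.Vec as Vec
open import Data.Vec.Properties using (lookup∘tabulate; []=⇒lookup; lookup⇒[]=)
open import Data.Vec.Functional using (Vector; head; tail)
import Data.Vec.Functional as Vector
open import Data.Vec.Functional.Relation.Binary.Pointwise using (Pointwise)
open import Function using (id; _∘_; Equivalence; Injection; Inverse; mk⇔)
open import Function.Properties.Inverse using (↔⇒↣)
open import Level using (0ℓ)
open import Relation.Binary using (tri<; tri≈; tri>)
open import Relation.Binary.Construct.Closure.Transitive using (TransClosure; [_]; _∷_; transitive⁻)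
open import Relation.Binary.Definitions using (Reflexive; Symmetric; _Respects_)
open import Relation.Binary.PropositionalEquality
  using (_≡_; _≢_; _≗_; refl; sym; trans; cong; cong₂; subst; subst₂; ≢-sym; module ≡-Reasoning)
open import Relation.Nullary
  using (Dec; yes; no; does; ¬?; _×-dec_; _⊎-dec_; _→-dec_; contradiction)
open import Relation.Nullary.Decidable using (map′; decidable-stable; dec-true; dec-false)
open import Relation.Unary using (Pred; Decidable)

private
  variable
    c k n : ℕ
    I J : Set
    R R′ B B′ : Rel n

-- Relations are functions, so they can only be searched up to pointwise equality.
Exhaustible : (A : Set) → (A → A → Set) → Set₁
Exhaustible A _≈_ = ∀ {P : Pred A 0ℓ} → P Respects _≈_ → Decidable P → Dec (∃ P)

Bool-exhaustible : Exhaustible Bool _≡_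
Bool-exhaustible _ P? = map′
  (λ { (inj₁ p) → true , p ; (inj₂ p) → false , p })
  (λ { (true , p) → inj₁ p ; (false , p) → inj₂ p })
  (P? true ⊎-dec P? false)

Vector-exhaustible : ∀ {A _≈_} → Reflexive _≈_ → Exhaustible A _≈_ →
                     ∀ n → Exhaustible (Vector A n) (Pointwise _≈_)
Vector-exhaustible ≈-refl A-exh zero resp P? =
  map′ (Vector.[] ,_) (λ (v , p) → resp (λ ()) p) (P? Vector.[])
Vector-exhaustible {_≈_ = _≈_} ≈-refl A-exh (suc n) resp P? =
  map′ (λ (x , xs , p) → x Vector.∷ xs , p) (λ (v , p) → head v , tail v , resp head∷tail p)
       (A-exh (λ x≈y (xs , p) → xs , resp (∷⁺ x≈y (λ _ → ≈-refl)) p)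
              (λ x → Vector-exhaustible ≈-refl A-exh n (λ xs≈ys → resp (∷⁺ ≈-refl xs≈ys))
                                                      (P? ∘ (x Vector.∷_))))
  where
  head∷tail : ∀ {v} → Pointwise _≈_ v (head v Vector.∷ tail v)
  head∷tail zero = ≈-refl
  head∷tail (suc i) = ≈-refl
  ∷⁺ : ∀ {x y xs ys} → x ≈ y → Pointwise _≈_ xs ys → Pointwise _≈_ (x Vector.∷ xs) (y Vector.∷ ys)
  ∷⁺ x≈y xs≈ys zero = x≈y
  ∷⁺ x≈y xs≈ys (suc i) = xs≈ys i

∀-decidable : ∀ {A _≈_} {P : Pred A 0ℓ} → Symmetric _≈_ → Exhaustible A _≈_ →
              P Respects _≈_ → Decidable P → Dec (∀ x → P x)
∀-decidable ≈-sym A-exh resp P? =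
  map′ (λ ∄¬P x → decidable-stable (P? x) (λ ¬Px → ∄¬P (x , ¬Px)))
       (λ ∀P (x , ¬Px) → ¬Px (∀P x))
       (¬? (A-exh (λ x≈y ¬Px Py → ¬Px (resp (≈-sym x≈y) Py)) (¬? ∘ P?)))

∃-greatest : ∀ {P : Pred ℕ 0ℓ} → Decidable P → P 0 → ∀ b → (∀ {k} → P k → k ≤ b) →
             ∃[ d ] (P d × ∀ {k} → P k → k ≤ d)
∃-greatest P? P0 zero ≤b = 0 , P0 , ≤b
∃-greatest {P} P? P0 (suc b) ≤b with P? (suc b)
... | yes Pb = suc b , Pb , ≤b
... | no ¬Pb = ∃-greatest P? P0 b (λ Pk → s≤s⁻¹ (≤∧≢⇒< (≤b Pk) (λ k≡1+b → ¬Pb (subst P k≡1+b Pk))))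

infix 4 _≈_ _⊆_

_≈_ : Rel n → Rel n → Set
_≈_ = Pointwise (Pointwise _≡_)

_⊆_ : Rel n → Rel n → Set
R ⊆ B = ∀ a b → R a b ≡ true → B a b ≡ true

≈-refl : R ≈ R
≈-refl _ _ = refl

≈-sym : R ≈ R′ → R′ ≈ R
≈-sym R≈R′ a b = sym (R≈R′ a b)

≈⇒⊆ : R ≈ R′ → R ⊆ R′
≈⇒⊆ R≈R′ a b = trans (sym (R≈R′ a b))

IsPartialOrder-resp : R ≈ R′ → IsPartialOrder R → IsPartialOrder R′
IsPartialOrder-resp R≈R′ (irrefl , transitive) =
  (λ a → trans (sym (R≈R′ a a)) (irrefl a)) ,
  (λ a b c Rab Rbc → ≈⇒⊆ R≈R′ a c
    (transitive a b c (≈⇒⊆ (≈-sym R≈R′) a b Rab) (≈⇒⊆ (≈-sym R≈R′) b c Rbc)))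

IsTotalOrder-resp : R ≈ R′ → IsTotalOrder R → IsTotalOrder R′
IsTotalOrder-resp R≈R′ (po , connex) =
  IsPartialOrder-resp R≈R′ po ,
  (λ a b a≢b → Sum.map (≈⇒⊆ R≈R′ a b) (≈⇒⊆ R≈R′ b a) (connex a b a≢b))

Distinct-resp : R ≈ R′ → B ≈ B′ → Distinct R B → Distinct R′ B′
Distinct-resp R≈R′ B≈B′ (a , b , Rab≢Bab) =
  a , b , λ R′ab≡B′ab → Rab≢Bab (trans (R≈R′ a b) (trans R′ab≡B′ab (sym (B≈B′ a b))))

TransClosure-map : ∀ {A : Set} {E E′ : A → A → Set} → (∀ {x y} → E x y → E′ x y) →
                   ∀ {x y} → TransClosure E x y → TransClosure E′ x y
TransClosure-map f [ e ] = [ f e ]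
TransClosure-map f (e ∷ es) = f e ∷ TransClosure-map f es

Compatible-resp : R ≈ R′ → B ≈ B′ → Compatible R B → Compatible R′ B′
Compatible-resp {R = R} {R′ = R′} {B = B} {B′ = B′} R≈R′ B≈B′ acyclic a cycle =
  acyclic a (TransClosure-map edge cycle)
  where
  edge : ∀ {x y} → UnionEdge R′ B′ x y → UnionEdge R B x y
  edge {x} {y} = Sum.map (≈⇒⊆ (≈-sym R≈R′) x y) (≈⇒⊆ (≈-sym B≈B′) x y)

⊆⇒Compatible : IsPartialOrder B → R ⊆ B → Compatible R B
⊆⇒Compatible (irrefl , transitive) R⊆B a cycle with () ←
  trans (sym (irrefl a)) (transitive⁻ _ (transitive _ _ _) (TransClosure-map [ R⊆B _ _ , id ]′ cycle))

Compatible⇒⊆ : IsTotalOrder B → Compatible R B → R ⊆ B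
Compatible⇒⊆ (_ , connex) acyclic a b Rab with a ≟ b
... | yes refl = ⊥-elim (acyclic a [ inj₁ Rab ])
... | no a≢b = [ id , (λ Bba → ⊥-elim (acyclic a (inj₁ Rab ∷ [ inj₂ Bba ]))) ]′ (connex a b a≢b)

isPartialOrder? : (R : Rel n) → Dec (IsPartialOrder R)
isPartialOrder? R =
  all? (λ a → R a a ≟ᵇ false) ×-dec
  all? (λ a → all? λ b → all? λ c → (R a b ≟ᵇ true) →-dec (R b c ≟ᵇ true) →-dec (R a c ≟ᵇ true))

isTotalOrder? : (R : Rel n) → Dec (IsTotalOrder R)
isTotalOrder? R =
  isPartialOrder? R ×-dec
  all? (λ a → all? λ b → ¬? (a ≟ b) →-dec ((R a b ≟ᵇ true) ⊎-dec (R b a ≟ᵇ true)))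

distinct? : (R B : Rel n) → Dec (Distinct R B)
distinct? R B = any? λ a → any? λ b → ¬? (R a b ≟ᵇ B a b)

_⊆?_ : (R B : Rel n) → Dec (R ⊆ B)
R ⊆? B = all? λ a → all? λ b → (R a b ≟ᵇ true) →-dec (B a b ≟ᵇ true)

compatible? : IsTotalOrder B → (R : Rel n) → Dec (Compatible R B)
compatible? {B = B} total R = map′ (⊆⇒Compatible (proj₁ total)) (Compatible⇒⊆ total) (R ⊆? B)

IsTrace : (I → Rel n) → Rel n → (I → Bool) → Set
IsTrace f B χ = ∀ i → (Compatible (f i) B → χ i ≡ true) × (χ i ≡ true → Compatible (f i) B)

-- Shattered S unfolds to ShatteredFamily (lookup S); general index types allow reindexing.
ShatteredFamily : (I → Rel n) → Set
ShatteredFamily {I = I} f = ∀ (χ : I → Bool) → ∃[ B ] (IsTotalOrder B × IsTrace f B χ)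

IsTrace-resp : ∀ {f f′ : I → Rel n} {χ χ′} →
               (∀ i → f i ≈ f′ i) → B ≈ B′ → χ ≗ χ′ → IsTrace f B χ → IsTrace f′ B′ χ′
IsTrace-resp f≈f′ B≈B′ χ≗χ′ trace i =
  Product.map (λ to → trans (sym (χ≗χ′ i)) ∘ to ∘ Compatible-resp (≈-sym (f≈f′ i)) (≈-sym B≈B′))
              (λ from → Compatible-resp (f≈f′ i) B≈B′ ∘ from ∘ trans (χ≗χ′ i))
              (trace i)

ShatteredFamily-reindex : ∀ {f : I → Rel n} {g : J → Rel n} (h : J → I) (h⁻¹ : I → J) →
                          (∀ j → h⁻¹ (h j) ≡ j) → (∀ j → f (h j) ≈ g j) →
                          ShatteredFamily f → ShatteredFamily g
ShatteredFamily-reindex h h⁻¹ inverse f∘h≈g shattered χ =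
  Product.map₂ (Product.map₂ (λ trace → IsTrace-resp f∘h≈g ≈-refl (cong χ ∘ inverse) (trace ∘ h)))
               (shattered (χ ∘ h⁻¹))

Shattered-tabulate : {f : Fin k → Rel n} → ShatteredFamily f → Shattered (tabulate f)
Shattered-tabulate {k = k} {f = f} =
  ShatteredFamily-reindex (cast L≡k) (cast (sym L≡k)) (cast-involutive (sym L≡k) L≡k)
    (λ j a b → cong (λ R → R a b) (trans (sym (lookup-tabulate f (cast L≡k j)))
                                         (cong (lookup (tabulate f)) (cast-involutive (sym L≡k) L≡k j))))
  where
  L≡k : length (tabulate f) ≡ k
  L≡k = length-tabulate f

Rel-exhaustible : Exhaustible (Rel n) _≈_
Rel-exhaustible {n} = Vector-exhaustible (λ _ → refl) (Vector-exhaustible refl Bool-exhaustible n) n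

isTrace? : IsTotalOrder B → (f : Fin k → Rel n) (χ : Fin k → Bool) → Dec (IsTrace f B χ)
isTrace? total f χ =
  all? λ i → (compatible? total (f i) →-dec (χ i ≟ᵇ true)) ×-dec
             ((χ i ≟ᵇ true) →-dec compatible? total (f i))

shatteredFamily? : (f : Fin k → Rel n) → Dec (ShatteredFamily f)
shatteredFamily? {k} {n} f =
  ∀-decidable (λ χ≗χ′ i → sym (χ≗χ′ i)) (Vector-exhaustible refl Bool-exhaustible k) resp-χ
    (λ χ → Rel-exhaustible resp-B (totalTrace? χ))
  where
  totalTrace? : ∀ χ (B : Rel n) → Dec (IsTotalOrder B × IsTrace f B χ)
  totalTrace? χ B with isTotalOrder? B
  ... | yes total = map′ (total ,_) proj₂ (isTrace? total f χ)
  ... | no ¬total = no (¬total ∘ proj₁)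
  resp-B : ∀ {χ} {B B′ : Rel n} → B ≈ B′ →
           IsTotalOrder B × IsTrace f B χ → IsTotalOrder B′ × IsTrace f B′ χ
  resp-B B≈B′ = Product.map (IsTotalOrder-resp B≈B′) (IsTrace-resp (λ _ → ≈-refl) B≈B′ (λ _ → refl))
  resp-χ : ∀ {χ χ′} → χ ≗ χ′ →
           ∃[ B ] (IsTotalOrder B × IsTrace f B χ) → ∃[ B ] (IsTotalOrder B × IsTrace f B χ′)
  resp-χ χ≗χ′ = Product.map₂ (Product.map₂ (IsTrace-resp (λ _ → ≈-refl) ≈-refl χ≗χ′))

isSubsetOfF? : (S : List (Rel n)) → Dec (IsSubsetOfF S)
isSubsetOfF? S = All.all? isPartialOrder? S ×-dec AllPairs.allPairs? distinct? S

IsSubsetOfF-resp : ∀ {S S′ : List (Rel n)} → Listʷ.Pointwise _≈_ S S′ →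
                   IsSubsetOfF S → IsSubsetOfF S′
IsSubsetOfF-resp S≈S′ =
  Product.map (Listʷ.All-resp-Pointwise IsPartialOrder-resp S≈S′)
              (Listʷ.AllPairs-resp-Pointwise
                (Distinct-resp ≈-refl , (λ R≈R′ → Distinct-resp R≈R′ ≈-refl)) S≈S′)

HasShatteredSubset : ℕ → ℕ → Set
HasShatteredSubset n k = ∃[ S ] (IsSubsetOfF {n} S × Shattered S × length S ≡ k)

hasShatteredSubset? : ∀ n k → Dec (HasShatteredSubset n k)
hasShatteredSubset? n k =
  map′ (λ (f , sub , shattered) → tabulate f , sub , Shattered-tabulate shattered , length-tabulate f)
       (λ { (S , sub , shattered , refl) →
              lookup S , subst IsSubsetOfF (sym (tabulate-lookup S)) sub , shattered })
       (Vector-exhaustible ≈-refl Rel-exhaustible k resp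
          (λ f → isSubsetOfF? (tabulate f) ×-dec shatteredFamily? f))
  where
  resp : ∀ {f f′ : Fin k → Rel n} → (∀ i → f i ≈ f′ i) →
         IsSubsetOfF (tabulate f) × ShatteredFamily f → IsSubsetOfF (tabulate f′) × ShatteredFamily f′
  resp f≈f′ = Product.map (IsSubsetOfF-resp (Listʷ.tabulate⁺ f≈f′))
                          (ShatteredFamily-reindex id id (λ _ → refl) f≈f′)

funToFin-cong : ∀ {p q} {g g′ : Fin p → Fin q} → g ≗ g′ → funToFin g ≡ funToFin g′
funToFin-cong {zero} _ = refl
funToFin-cong {suc p} g≗g′ = cong₂ combine (g≗g′ zero) (funToFin-cong (g≗g′ ∘ suc))

funToFin-injective : ∀ {p q} {g g′ : Fin p → Fin q} → funToFin g ≡ funToFin g′ → g ≗ g′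
funToFin-injective {g = g} {g′} eq i =
  trans (sym (finToFun-funToFin g i)) (trans (cong (λ x → finToFun x i) eq) (finToFun-funToFin g′ i))

≗-injective⇒^≤ : ∀ {p q r s} (F : (Fin p → Fin q) → Fin r → Fin s) →
                 (∀ u v → F u ≗ F v → u ≗ v) → q ^ p ≤ s ^ r
≗-injective⇒^≤ {p} {q} F F-injective = injective⇒≤ λ {x} {y} Fx≡Fy → begin
  x                   ≡⟨ funToFin-finToFin {p} x ⟨
  funToFin (decode x) ≡⟨ funToFin-cong (F-injective _ _ (funToFin-injective Fx≡Fy)) ⟩
  funToFin (decode y) ≡⟨ funToFin-finToFin {p} y ⟩
  y                   ∎
  where
  open ≡-Reasoning
  decode : Fin (q ^ p) → Fin p → Fin q
  decode = finToFun

n<2^n : ∀ n → n < 2 ^ n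
n<2^n zero = s≤s z≤n
n<2^n (suc n) = +-mono-≤ (m^n>0 2 n) (≤-trans (n<2^n n) (m≤m+n (2 ^ n) 0))

predecessors : Rel n → Fin n → Subset n
predecessors B a = Vec.tabulate (λ c → B c a)

∈-predecessors : ∀ {B : Rel n} {a c} → c ∈ predecessors B a → B c a ≡ true
∈-predecessors {B = B} {a} {c} c∈ = trans (sym (lookup∘tabulate (λ x → B x a) c)) ([]=⇒lookup c∈)

predecessors-∈ : ∀ {B : Rel n} {a c} → B c a ≡ true → c ∈ predecessors B a
predecessors-∈ {B = B} {a} {c} Bca = lookup⇒[]= c _ (trans (lookup∘tabulate (λ x → B x a) c) Bca)

height : Rel n → Fin n → ℕ
height B a = ∣ predecessors B a ∣

height<n : {B : Rel n} → IsPartialOrder B → ∀ a → height B a < n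
height<n {B = B} (irrefl , _) a = subst₂ _<_ refl (∣⊤∣≡n _)
  (p⊂q⇒∣p∣<∣q∣ (⊆⊤ , a , ∈⊤ , λ a∈ →
    contradiction (trans (sym (∈-predecessors {B = B} a∈)) (irrefl a)) λ ()))

height-mono : {B : Rel n} → IsPartialOrder B → ∀ {a b} → B a b ≡ true → height B a < height B b
height-mono {B = B} (irrefl , transitive) {a} {b} Bab = p⊂q⇒∣p∣<∣q∣
  ( (λ c∈ → predecessors-∈ {B = B} (transitive _ a b (∈-predecessors {B = B} c∈) Bab))
  , a , predecessors-∈ {B = B} Bab
  , λ a∈ → contradiction (trans (sym (∈-predecessors {B = B} a∈)) (irrefl a)) λ ())

⊆-antisym : {R B : Rel n} → R ⊆ B → B ⊆ R → R ≈ B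
⊆-antisym R⊆B B⊆R a b = ⇔→≡ (mk⇔ (R⊆B a b) (B⊆R a b))

⊆-by-height : {B B′ : Rel n} (h : Fin n → ℕ) → IsPartialOrder B → IsTotalOrder B′ →
              (∀ {a b} → B a b ≡ true → h a < h b) → (∀ {a b} → B′ a b ≡ true → h a < h b) → B ⊆ B′
⊆-by-height h (irrefl , _) (_ , connex) B-mono B′-mono a b Bab with a ≟ b
... | yes refl = contradiction (trans (sym Bab) (irrefl a)) λ ()
... | no a≢b = [ id , (λ B′ba → contradiction (B′-mono B′ba) (<-asym (B-mono Bab))) ]′ (connex a b a≢b)

heights-determine : {B B′ : Rel n} → IsTotalOrder B → IsTotalOrder B′ → height B ≗ height B′ → B ≈ B′
heights-determine {B = B} {B′} total total′ eq =
  ⊆-antisym (⊆-by-height (height B) (proj₁ total) total′ (height-mono (proj₁ total)) B′-mono)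
            (⊆-by-height (height B) (proj₁ total′) total B′-mono (height-mono (proj₁ total)))
  where
  B′-mono : ∀ {a b} → B′ a b ≡ true → height B a < height B b
  B′-mono B′ab = subst₂ _<_ (sym (eq _)) (sym (eq _)) (height-mono (proj₁ total′) B′ab)

trace-determined : ∀ {I : Set} {f : I → Rel n} {B B′ χ χ′} →
                   IsTrace f B χ → IsTrace f B′ χ′ → B ≈ B′ → χ ≗ χ′
trace-determined trace trace′ B≈B′ i = ⇔→≡ (mk⇔
  (proj₁ (trace′ i) ∘ Compatible-resp ≈-refl B≈B′ ∘ proj₂ (trace i))
  (proj₁ (trace i) ∘ Compatible-resp ≈-refl (≈-sym B≈B′) ∘ proj₂ (trace′ i)))

shattered⇒2^k≤n^n : {f : Fin k → Rel n} → ShatteredFamily f → 2 ^ k ≤ n ^ n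
shattered⇒2^k≤n^n {k} {n} {f} shattered = ≗-injective⇒^≤ rank rank-injective
  where
  open Inverse 2↔Bool using (to; from; strictlyInverseʳ)
  order : (Fin k → Fin 2) → Rel n
  order u = proj₁ (shattered (to ∘ u))
  total : ∀ u → IsTotalOrder (order u)
  total u = proj₁ (proj₂ (shattered (to ∘ u)))
  trace : ∀ u → IsTrace f (order u) (to ∘ u)
  trace u = proj₂ (proj₂ (shattered (to ∘ u)))
  rank : (Fin k → Fin 2) → Fin n → Fin n
  rank u a = fromℕ< (height<n (proj₁ (total u)) a)
  rank-injective : ∀ u v → rank u ≗ rank v → u ≗ v
  rank-injective u v rank≗ i = begin
    u i             ≡⟨ strictlyInverseʳ (u i) ⟨
    from (to (u i)) ≡⟨ cong from (trace-determined (trace u) (trace v) order≈ i) ⟩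
    from (to (v i)) ≡⟨ strictlyInverseʳ (v i) ⟩
    v i             ∎
    where
    open ≡-Reasoning
    order≈ : order u ≈ order v
    order≈ = heights-determine (total u) (total v) (λ a → fromℕ<-injective _ _ _ _ (rank≗ a))

<⇒<ᵇ≡true : ∀ {x y} → x < y → (x <ᵇ y) ≡ true
<⇒<ᵇ≡true = Equivalence.to T-≡ ∘ <⇒<ᵇ

<ᵇ≡true⇒< : ∀ x y → (x <ᵇ y) ≡ true → x < y
<ᵇ≡true⇒< x y = <ᵇ⇒< x y ∘ Equivalence.from T-≡

≤⇒>ᵇ≡false : ∀ {x y} → y ≤ x → (x <ᵇ y) ≡ false
≤⇒>ᵇ≡false {x} {y} y≤x with x <ᵇ y in x<ᵇy
... | false = refl
... | true = contradiction (<ᵇ≡true⇒< x y x<ᵇy) (≤⇒≯ y≤x)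

keyOrder : (Fin n → ℕ) → Rel n
keyOrder key a b = key a <ᵇ key b

keyOrder-isTotalOrder : (key : Fin n → ℕ) → (∀ {a b} → key a ≡ key b → a ≡ b) →
                        IsTotalOrder (keyOrder key)
keyOrder-isTotalOrder key key-injective = (irrefl , transitive) , connex
  where
  irrefl : ∀ a → keyOrder key a a ≡ false
  irrefl a = ≤⇒>ᵇ≡false {key a} ≤-refl
  transitive : ∀ a b c → keyOrder key a b ≡ true → keyOrder key b c ≡ true → keyOrder key a c ≡ true
  transitive a b c ab bc =
    <⇒<ᵇ≡true (<-trans (<ᵇ≡true⇒< (key a) (key b) ab) (<ᵇ≡true⇒< (key b) (key c) bc))
  connex : ∀ a b → a ≢ b → (keyOrder key a b ≡ true) ⊎ (keyOrder key b a ≡ true)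
  connex a b a≢b with <-cmp (key a) (key b)
  ... | tri< lt _ _ = inj₁ (<⇒<ᵇ≡true lt)
  ... | tri≈ _ eq _ = contradiction (key-injective eq) a≢b
  ... | tri> _ _ gt = inj₂ (<⇒<ᵇ≡true gt)

-- Compares by code first and breaks ties by the element itself.
lexOrder : (Fin n → Fin c) → Rel n
lexOrder code = keyOrder (λ a → toℕ (combine (code a) a))

lexOrder-isTotalOrder : (code : Fin n → Fin c) → IsTotalOrder (lexOrder code)
lexOrder-isTotalOrder code = keyOrder-isTotalOrder _ λ {a} {b} eq →
  proj₂ (combine-injective (code a) a (code b) b (toℕ-injective eq))

lexOrder-code : (code : Fin n → Fin c) → ∀ {a b} → code a ≢ code b →
                lexOrder code a b ≡ (toℕ (code a) <ᵇ toℕ (code b))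
lexOrder-code code {a} {b} codes≢ with <-cmp (toℕ (code a)) (toℕ (code b))
... | tri< lt _ _ =
  trans (<⇒<ᵇ≡true (combine-monoˡ-< {i = code a} {code b} a b lt)) (sym (<⇒<ᵇ≡true lt))
... | tri≈ _ eq _ = contradiction (toℕ-injective eq) codes≢
... | tri> _ _ gt =
  trans (≤⇒>ᵇ≡false (<⇒≤ (combine-monoˡ-< {i = code b} {code a} b a gt))) (sym (≤⇒>ᵇ≡false (<⇒≤ gt)))

pattern low = zero
pattern mid = suc zero
pattern high = suc (suc zero)
pattern elt k = suc (suc (suc k))

between : ∀ {m} → Fin m → Rel (3 + m)
between k low high = true
between k low (elt j) = does (j ≟ k)
between k (elt j) high = does (j ≟ k)
between k _ _ = false

below-mid : ∀ {m} → Fin m → Rel (3 + m)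
below-mid k (elt j) mid = does (j ≟ k)
below-mid k _ _ = false

between-isPartialOrder : ∀ {m} (k : Fin m) → IsPartialOrder (between k)
between-isPartialOrder k = irrefl , transitive
  where
  irrefl : ∀ a → between k a a ≡ false
  irrefl low = refl
  irrefl mid = refl
  irrefl high = refl
  irrefl (elt _) = refl
  transitive : ∀ a b c → between k a b ≡ true → between k b c ≡ true → between k a c ≡ true
  transitive low (elt _) high _ _ = refl
  transitive low (elt _) low _ ()
  transitive low (elt _) mid _ ()
  transitive low (elt _) (elt _) _ ()
  transitive low low _ () _
  transitive low mid _ () _
  transitive _ high _ _ ()
  transitive mid _ _ () _
  transitive high _ _ () _
  transitive (elt _) low _ () _
  transitive (elt _) mid _ () _
  transitive (elt _) (elt _) _ () _

below-mid-isPartialOrder : ∀ {m} (k : Fin m) → IsPartialOrder (below-mid k)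
below-mid-isPartialOrder k = irrefl , transitive
  where
  irrefl : ∀ a → below-mid k a a ≡ false
  irrefl low = refl
  irrefl mid = refl
  irrefl high = refl
  irrefl (elt _) = refl
  transitive : ∀ a b c → below-mid k a b ≡ true → below-mid k b c ≡ true → below-mid k a c ≡ true
  transitive _ low _ _ ()
  transitive _ mid _ _ ()
  transitive _ high _ _ ()
  transitive low (elt _) _ () _
  transitive mid (elt _) _ () _
  transitive high (elt _) _ () _
  transitive (elt _) (elt _) _ () _

does-≟-true : ∀ {m} {j k : Fin m} → does (j ≟ k) ≡ true → j ≡ k
does-≟-true {j = j} {k} p with j ≟ k
... | yes j≡k = j≡k

between-⊆ : ∀ {m} {k : Fin m} {B : Rel (3 + m)} → IsPartialOrder B →
            (B low (elt k) ∧ B (elt k) high) ≡ true → between k ⊆ B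
between-⊆ (_ , transitive) both low high _ =
  transitive low (elt _) high (∧-conicalˡ _ _ both) (∧-conicalʳ _ _ both)
between-⊆ {k = k} _ both low (elt j) p with refl ← does-≟-true {j = j} {k} p = ∧-conicalˡ _ _ both
between-⊆ {k = k} _ both (elt j) high p with refl ← does-≟-true {j = j} {k} p = ∧-conicalʳ _ _ both
between-⊆ _ _ low low ()
between-⊆ _ _ low mid ()
between-⊆ _ _ mid _ ()
between-⊆ _ _ high _ ()
between-⊆ _ _ (elt _) low ()
between-⊆ _ _ (elt _) mid ()
between-⊆ _ _ (elt _) (elt _) ()

below-mid-⊆ : ∀ {m} {k : Fin m} {B : Rel (3 + m)} → B (elt k) mid ≡ true → below-mid k ⊆ B
below-mid-⊆ {k = k} e<mid (elt j) mid p with refl ← does-≟-true {j = j} {k} p = e<mid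
below-mid-⊆ _ low _ ()
below-mid-⊆ _ mid _ ()
below-mid-⊆ _ high _ ()
below-mid-⊆ _ (elt _) low ()
below-mid-⊆ _ (elt _) high ()
below-mid-⊆ _ (elt _) (elt _) ()

between-trace : ∀ {m} {k : Fin m} {B : Rel (3 + m)} {α} → IsTotalOrder B →
                (B low (elt k) ∧ B (elt k) high) ≡ α →
                (Compatible (between k) B → α ≡ true) × (α ≡ true → Compatible (between k) B)
between-trace {k = k} total eq =
  (λ compatible → let B⊇ = Compatible⇒⊆ total compatible in
     trans (sym eq) (cong₂ _∧_ (B⊇ low (elt k) (dec-true (k ≟ k) refl))
                               (B⊇ (elt k) high (dec-true (k ≟ k) refl)))) ,
  (λ α≡true → ⊆⇒Compatible (proj₁ total) (between-⊆ (proj₁ total) (trans eq α≡true)))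

below-mid-trace : ∀ {m} {k : Fin m} {B : Rel (3 + m)} {γ} → IsTotalOrder B → B (elt k) mid ≡ γ →
                  (Compatible (below-mid k) B → γ ≡ true) × (γ ≡ true → Compatible (below-mid k) B)
below-mid-trace {k = k} total eq =
  (λ compatible → trans (sym eq) (Compatible⇒⊆ total compatible (elt k) mid (dec-true (k ≟ k) refl))) ,
  (λ γ≡true → ⊆⇒Compatible (proj₁ total) (below-mid-⊆ (trans eq γ≡true)))

region : Bool → Bool → Fin 7
region false true  = # 0
region true  true  = # 2
region true  false = # 4
region false false = # 6

region-avoids-poles : ∀ α γ → region α γ ≢ # 1 × region α γ ≢ # 3 × region α γ ≢ # 5
region-avoids-poles false true  = (λ ()) , (λ ()) , (λ ())
region-avoids-poles true  true  = (λ ()) , (λ ()) , (λ ())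
region-avoids-poles true  false = (λ ()) , (λ ()) , (λ ())
region-avoids-poles false false = (λ ()) , (λ ()) , (λ ())

region-between : ∀ α γ → ((1 <ᵇ toℕ (region α γ)) ∧ (toℕ (region α γ) <ᵇ 5)) ≡ α
region-between false true  = refl
region-between true  true  = refl
region-between true  false = refl
region-between false false = refl

region-below : ∀ α γ → (toℕ (region α γ) <ᵇ 3) ≡ γ
region-below false true  = refl
region-below true  true  = refl
region-below true  false = refl
region-below false false = refl

-- The poles sit at 1 < 3 < 5, and elt k in the gap 0, 2, 4 or 6 selected by its two bits.
position : ∀ {m} → (Fin m ⊎ Fin m → Bool) → Fin (3 + m) → Fin 7
position χ low = # 1
position χ mid = # 3
position χ high = # 5
position χ (elt k) = region (χ (inj₁ k)) (χ (inj₂ k))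

order : ∀ {m} → (Fin m ⊎ Fin m → Bool) → Rel (3 + m)
order χ = lexOrder (position χ)

order-between : ∀ {m} (χ : Fin m ⊎ Fin m → Bool) k →
                (order χ low (elt k) ∧ order χ (elt k) high) ≡ χ (inj₁ k)
order-between χ k with region-avoids-poles (χ (inj₁ k)) (χ (inj₂ k))
... | ≢1 , _ , ≢5 = begin
  order χ low (elt k) ∧ order χ (elt k) high
    ≡⟨ cong₂ _∧_ (lexOrder-code (position χ) {low} {elt k} (≢-sym ≢1))
                 (lexOrder-code (position χ) {elt k} {high} ≢5) ⟩
  (1 <ᵇ toℕ (position χ (elt k))) ∧ (toℕ (position χ (elt k)) <ᵇ 5)
    ≡⟨ region-between (χ (inj₁ k)) (χ (inj₂ k)) ⟩
  χ (inj₁ k) ∎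
  where open ≡-Reasoning

order-below-mid : ∀ {m} (χ : Fin m ⊎ Fin m → Bool) k → order χ (elt k) mid ≡ χ (inj₂ k)
order-below-mid χ k with region-avoids-poles (χ (inj₁ k)) (χ (inj₂ k))
... | _ , ≢3 , _ =
  trans (lexOrder-code (position χ) {elt k} {mid} ≢3) (region-below (χ (inj₁ k)) (χ (inj₂ k)))

family : ∀ {m} → Fin m ⊎ Fin m → Rel (3 + m)
family (inj₁ k) = between k
family (inj₂ k) = below-mid k

family-isPartialOrder : ∀ {m} (s : Fin m ⊎ Fin m) → IsPartialOrder (family s)
family-isPartialOrder (inj₁ k) = between-isPartialOrder k
family-isPartialOrder (inj₂ k) = below-mid-isPartialOrder k

does-≟-≢ : ∀ {m} {j j′ : Fin m} → j ≢ j′ → does (j ≟ j) ≢ does (j ≟ j′)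
does-≟-≢ {j = j} {j′} j≢j′ rewrite dec-true (j ≟ j) refl | dec-false (j ≟ j′) j≢j′ = λ ()

family-distinct : ∀ {m} {s t : Fin m ⊎ Fin m} → s ≢ t → Distinct (family s) (family t)
family-distinct {s = inj₁ j} {inj₁ _} s≢t = low , elt j , does-≟-≢ (s≢t ∘ cong inj₁)
family-distinct {s = inj₁ _} {inj₂ _} _ = low , high , λ ()
family-distinct {s = inj₂ _} {inj₁ _} _ = low , high , λ ()
family-distinct {s = inj₂ j} {inj₂ _} s≢t = elt j , mid , does-≟-≢ (s≢t ∘ cong inj₂)

family-shattered : ∀ {m} → ShatteredFamily (family {m})
family-shattered χ = order χ , total , trace
  where
  total : IsTotalOrder (order χ)
  total = lexOrder-isTotalOrder (position χ)
  trace : IsTrace family (order χ) χ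
  trace (inj₁ k) = between-trace total (order-between χ k)
  trace (inj₂ k) = below-mid-trace total (order-below-mid χ k)

HasShatteredSubset-family : ∀ m → HasShatteredSubset (3 + m) (m + m)
HasShatteredSubset-family m =
  tabulate (family ∘ splitAt m) ,
  ( All.tabulate⁺ (family-isPartialOrder ∘ splitAt m)
  , AllPairs.tabulate⁺ (λ i≢j → family-distinct (i≢j ∘ splitAt-injective)) ) ,
  Shattered-tabulate
    (ShatteredFamily-reindex (splitAt m) (join m m) (join-splitAt m m) (λ _ → ≈-refl) family-shattered) ,
  length-tabulate (family ∘ splitAt m)
  where
  splitAt-injective : ∀ {i j} → splitAt m i ≡ splitAt m j → i ≡ j
  splitAt-injective = Injection.injective (↔⇒↣ (+↔⊎ {m} {m}))

HasShatteredSubset-empty : ∀ n → HasShatteredSubset n 0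
HasShatteredSubset-empty n =
  [] , ([] , []) , (λ _ → keyOrder toℕ , keyOrder-isTotalOrder toℕ toℕ-injective , λ ()) , refl

HasShatteredSubset⇒2^k≤n^n : HasShatteredSubset n k → 2 ^ k ≤ n ^ n
HasShatteredSubset⇒2^k≤n^n (S , _ , shattered , refl) = shattered⇒2^k≤n^n shattered

2*[n∸3]≤ : ∀ n {d} → (∀ {k} → HasShatteredSubset n k → k ≤ d) → 2 * (n ∸ 3) ≤ d
2*[n∸3]≤ zero _ = z≤n
2*[n∸3]≤ (suc zero) _ = z≤n
2*[n∸3]≤ (suc (suc zero)) _ = z≤n
2*[n∸3]≤ (suc (suc (suc m))) {d} maximal =
  subst (_≤ d) (cong (m +_) (sym (+-identityʳ m))) (maximal (HasShatteredSubset-family m))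

theorem2 : (n : ℕ) → 1 ≤ n →
    ∃[ d ] (IsVCDim n d × (2 * (n ∸ 3) ≤ d) × (2 ^ d ≤ n ^ n))
theorem2 n _ with ∃-greatest (hasShatteredSubset? n) (HasShatteredSubset-empty n) (n ^ n)
                    (λ has-k → ≤-trans (<⇒≤ (n<2^n _)) (HasShatteredSubset⇒2^k≤n^n has-k))
... | d , has-d , maximal =
  d , (has-d , λ S sub shattered → maximal (S , sub , shattered , refl)) ,
  2*[n∸3]≤ n maximal , HasShatteredSubset⇒2^k≤n^n has-d
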